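{- Let $w_1,w_2,d\in\mathbb{N}$ with $d\equiv w_1\equiv w_2\equiv 1\pmod 2$, let $\chi$ be a Dirichlet character with conductor $d$, and let $\lambda\neq0$ be a parameter. Then for every integer $n\ge 0$, \[ w_{2}^{n}\sum_{l=0}^{dw_{2}-1}(-1)^{l}\chi(l)\,\mathcal{E}_{n,\frac{\lambda}{w_{2}},\chi}\!\left(w_{1}x+\frac{w_{1}}{w_{2}}l\right) =w_{1}^{n}\sum_{l=0}^{dw_{1}-1}(-1)^{l}\chi(l)\,\mathcal{E}_{n,\frac{\lambda}{w_{1}},\chi}\!\left(w_{2}x+\frac{w_{2}}{w_{1}}l\right). \]
   Context: For $d\in\mathbb{N}$ odd, a Dirichlet character $\chi$ with conductor $d$, and a nonzero parameter $\mu$, the generalized degenerate Euler polynomials $\mathcal{E}_{n,\mu,\chi}(x)$ attached to $\chi$ are defined by the generating function (formal power series in $t$) \[ \frac{2\sum_{a=0}^{d-1}(-1)^{a}\chi(a)(1+\mu t)^{a/\mu}}{(1+\mu t)^{d/\mu}+1}\,(1+\mu t)^{x/\mu}=\sum_{n=0}^{\infty}\mathcal{E}_{n,\mu,\chi}(x)\frac{t^{n}}{n!}. \] -}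

module Defs where

open import Level using (Level; _⊔_) renaming (suc to lsuc)
open import Algebra.Bundles using (CommutativeRing)
open import Data.Nat as ℕ using (ℕ; zero; suc)
open import Data.Nat.Combinatorics using (_C_)
open import Data.Nat.DivMod using (_%_)
open import Data.Integer as ℤ using (ℤ)
open import Data.Integer.GCD using (gcd)
open import Data.Bool using (if_then_else_)
open import Relation.Nullary using (¬_; does)
open import Relation.Binary.PropositionalEquality using (_≡_)

Odd : ℕ → Set
Odd n = n % 2 ≡ 1

record Field (c ℓ : Level) : Set (lsuc (c ⊔ ℓ)) where
  field
    commutativeRing : CommutativeRing c ℓ
  open CommutativeRing commutativeRing public hiding (zero)
  field
    _⁻¹        : Carrier → Carrier
    ⁻¹-cong    : ∀ {x y} → x ≈ y → x ⁻¹ ≈ y ⁻¹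
    ⁻¹-inverse : ∀ x → ¬ (x ≈ 0#) → x * x ⁻¹ ≈ 1#
    0≉1        : ¬ (0# ≈ 1#)

  ι : ℕ → Carrier
  ι zero    = 0#
  ι (suc n) = 1# + ι n

  _^_ : Carrier → ℕ → Carrier
  x ^ zero  = 1#
  x ^ suc n = x * (x ^ n)

  sumTo : ℕ → (ℕ → Carrier) → Carrier
  sumTo zero    f = 0#
  sumTo (suc n) f = sumTo n f + f n

-- Fields of characteristic zero (the paper works over ℂ).
record CharZeroField (c ℓ : Level) : Set (lsuc (c ⊔ ℓ)) where
  field
    field' : Field c ℓ
  open Field field' public
  field
    char0 : ∀ n → ¬ (ι (suc n) ≈ 0#)

module Ops {c ℓ : Level} (F : CharZeroField c ℓ) where
  open CharZeroField F

  -- Degenerate falling factorial (x)_{n,μ} = x (x-μ) ⋯ (x-(n-1)μ);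
  -- (1+μt)^{x/μ} = Σ_n (x)_{n,μ} tⁿ/n!.
  dff : Carrier → Carrier → ℕ → Carrier
  dff x μ zero    = 1#
  dff x μ (suc n) = dff x μ n * (x - ι n * μ)

  -- Coefficients of exponential generating functions (Σ aₙ tⁿ/n!).
  -- Product of EGFs:  (a ⊛ b)ₙ = Σ_{k≤n} C(n,k) a_k b_{n-k}.
  _⊛_ : (ℕ → Carrier) → (ℕ → Carrier) → (ℕ → Carrier)
  (a ⊛ b) n = sumTo (suc n) (λ k → ι (n C k) * a k * b (n ℕ.∸ k))

  -- Quotient N / D of EGFs (D₀ invertible): the unique q with q ⊛ D = N,
  -- computed coefficientwise: qₙ = (Nₙ - Σ_{k<n} C(n,k) q_k D_{n-k}) D₀⁻¹.
  private
    qtab : (ℕ → Carrier) → (ℕ → Carrier) → ℕ → (ℕ → Carrier)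
    qtab N D zero    = λ _ → N 0 * D 0 ⁻¹
    qtab N D (suc n) = λ k → if does (k ℕ.≤? n) then qtab N D n k else
      ((N (suc n) - sumTo (suc n)
          (λ j → ι (suc n C j) * qtab N D n j * D (suc n ℕ.∸ j))) * D 0 ⁻¹)

  egfDiv : (ℕ → Carrier) → (ℕ → Carrier) → (ℕ → Carrier)
  egfDiv N D n = qtab N D n n

  sgn : ℕ → Carrier
  sgn a = (- 1#) ^ a

  -- Coefficients of the numerator 2 Σ_{a=0}^{d-1} (-1)^a χ(a) (1+μt)^{a/μ}.
  numer : ℕ → (ℤ → Carrier) → Carrier → (ℕ → Carrier)
  numer d χ μ n = ι 2 * sumTo d (λ a → sgn a * χ (ℤ.+ a) * dff (ι a) μ n)

  -- Coefficients of the denominator (1+μt)^{d/μ} + 1.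
  denom : ℕ → Carrier → (ℕ → Carrier)
  denom d μ zero    = dff (ι d) μ zero + 1#
  denom d μ (suc n) = dff (ι d) μ (suc n)

  -- Generalized degenerate Euler polynomials 𝓔_{n,μ,χ}(x) : coefficients
  -- (w.r.t. tⁿ/n!) of  [numerator / denominator] · (1+μt)^{x/μ}.
  E : ℕ → (ℤ → Carrier) → Carrier → ℕ → Carrier → Carrier
  E d χ μ n x = (egfDiv (numer d χ μ) (denom d μ) ⊛ dff x μ) n

record IsDirichletChar {c ℓ} (F : CharZeroField c ℓ) (d : ℕ)
                       (χ : ℤ → CharZeroField.Carrier F) : Set ℓ where
  open CharZeroField F
  field
    periodic      : ∀ a → χ (a ℤ.+ ℤ.+ d) ≈ χ a
    multiplicative : ∀ a b → χ (a ℤ.* b) ≈ χ a * χ b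
    χ-one         : χ (ℤ.+ 1) ≈ 1#
    coprime⇒≉0    : ∀ a → gcd a (ℤ.+ d) ≡ ℤ.+ 1 → ¬ (χ a ≈ 0#)
    ¬coprime⇒≈0   : ∀ a → ¬ (gcd a (ℤ.+ d) ≡ ℤ.+ 1) → χ a ≈ 0#

InducedModulus : ∀ {c ℓ} (F : CharZeroField c ℓ) (d : ℕ)
                 (χ : ℤ → CharZeroField.Carrier F) → ℕ → Set ℓ
InducedModulus F d χ d' =
  ∀ a → gcd a (ℤ.+ d) ≡ ℤ.+ 1 → (ℤ.+ d') ∣ℤ (a ℤ.- ℤ.+ 1) → χ a ≈ 1#
  where
    open CharZeroField F
    open import Data.Integer.Divisibility using () renaming (_∣_ to _∣ℤ_)

HasConductor : ∀ {c ℓ} (F : CharZeroField c ℓ) (d : ℕ)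
               (χ : ℤ → CharZeroField.Carrier F) → Set ℓ
HasConductor F d χ =
  ∀ d' → d' ∣ d → d' ℕ.< d → ¬ InducedModulus F d χ d'
  where open import Data.Nat.Divisibility using (_∣_)

-- Everything is an identity of exponential generating functions, encoded
-- as coefficient sequences. Put u(y) = (1 + λt)^{y/λ}, ε(l) = (-1)^l χ(l),
-- A_w = Σ_{a<d} ε(a) u(w a) and D_w = u(w d) + 1. Rescaling t ↦ w t turns
-- the generating function of 𝓔_{n,λ/w,χ}(y) into (2 A_w / D_w) u(w y).
-- Since d is odd and χ has period d, splitting l < d w as l = j d + a gives
-- Σ_{l<dw} ε(l) u(w′ l) = A_{w′} Σ_{j<w} (-u(w′ d))^j = A_{w′} D_{ww′} / D_{w′}
-- for odd w. So the left-hand side is the n-th coefficient of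
-- 2 A_{w₁} A_{w₂} u(w₁ w₂ x) D_{w₁w₂} / (D_{w₁} D_{w₂}), which is symmetric
-- in w₁ and w₂; the division is avoided by cancelling D_{w₁} D_{w₂}, whose
-- constant term is nonzero.

module Submission where

open import Defs
open import Level using (Level)
open import Algebra.Bundles using (Ring; CommutativeMonoid)
open import Algebra.Solver.Ring.AlmostCommutativeRing
  using (fromCommutativeRing; _-Raw-AlmostCommutative⟶_)
open import Data.Bool using (if_then_else_)
open import Data.Maybe using (Maybe; just; nothing)
open import Data.Nat as ℕ using (ℕ; zero; suc)
open import Data.Nat.Combinatorics using (_C_; nCk+nC[k+1]≡[n+1]C[k+1]; nCn≡1)
open import Data.Nat.Combinatorics.Specification using (k>n⇒nCk≡0)
open import Data.Nat.DivMod using (_/_; m≡m%n+[m/n]*n)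
import Data.Nat.Properties as ℕP
open import Data.Integer as ℤ using (ℤ; +_; -[1+_])
import Data.Integer.Properties as ℤP
open import Data.Sum using (inj₁; inj₂)
open import Data.Product using (_,_)
open import Relation.Binary.Bundles using (Setoid)
open import Relation.Binary.PropositionalEquality as ≡ using (_≡_)
open import Relation.Nullary using (¬_; yes; no)
open import Relation.Nullary.Decidable using (dec-true; dec-false)
import Relation.Binary.Reasoning.Setoid as SetoidReasoning

-- The ring solver's integer constants are read as n × 1#, whose optimised
-- definition makes the constant + 1 denote 1# itself.
module IntegerCoefficients {c ℓ : Level} (F : Field c ℓ) where
  open Field F
  open import Algebra.Properties.Ring ring
    using (-‿distribˡ-*; -‿involutive; -0#≈0#; -‿+-comm)
  open import Algebra.Properties.Semiring.Mult.TCOptimised semiring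
    using (_×_; 1+×; ×-homo-+)
  open SetoidReasoning setoid

  ⟦_⟧ : ℤ → Carrier
  ⟦ + n ⟧      = n × 1#
  ⟦ -[1+ n ] ⟧ = - (suc n × 1#)

  ⟦⊖⟧ : ∀ m n → ⟦ m ℤ.⊖ n ⟧ ≈ m × 1# - n × 1#
  ⟦⊖⟧ zero    zero    = sym (trans (+-congˡ -0#≈0#) (+-identityʳ 0#))
  ⟦⊖⟧ zero    (suc n) = sym (+-identityˡ _)
  ⟦⊖⟧ (suc m) zero    = sym (trans (+-congˡ -0#≈0#) (+-identityʳ _))
  ⟦⊖⟧ (suc m) (suc n) = begin
    ⟦ suc m ℤ.⊖ suc n ⟧            ≡⟨ ≡.cong ⟦_⟧ (ℤP.[1+m]⊖[1+n]≡m⊖n m n) ⟩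
    ⟦ m ℤ.⊖ n ⟧                    ≈⟨ ⟦⊖⟧ m n ⟩
    m × 1# - n × 1#                ≈⟨ cancel-1# ⟨
    (1# + m × 1#) - (1# + n × 1#)  ≈⟨ +-cong (1+× m 1#) (-‿cong (1+× n 1#)) ⟨
    suc m × 1# - suc n × 1#        ∎
    where
    cancel-1# : (1# + m × 1#) - (1# + n × 1#) ≈ m × 1# - n × 1#
    cancel-1# = begin
      (1# + m × 1#) + - (1# + n × 1#)      ≈⟨ +-congˡ (-‿+-comm 1# _) ⟨
      (1# + m × 1#) + (- 1# + - (n × 1#))  ≈⟨ +-assoc _ _ _ ⟩
      1# + (m × 1# + (- 1# + - (n × 1#)))  ≈⟨ +-congˡ (+-assoc _ _ _) ⟨
      1# + ((m × 1# + - 1#) + - (n × 1#))  ≈⟨ +-congˡ (+-congʳ (+-comm _ _)) ⟩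
      1# + ((- 1# + m × 1#) + - (n × 1#))  ≈⟨ +-congˡ (+-assoc _ _ _) ⟩
      1# + (- 1# + (m × 1# - n × 1#))      ≈⟨ +-assoc _ _ _ ⟨
      (1# + - 1#) + (m × 1# - n × 1#)      ≈⟨ +-congʳ (-‿inverseʳ 1#) ⟩
      0# + (m × 1# - n × 1#)               ≈⟨ +-identityˡ _ ⟩
      m × 1# - n × 1#                      ∎

  ⟦-⟧ : ∀ i → ⟦ ℤ.- i ⟧ ≈ - ⟦ i ⟧
  ⟦-⟧ (+ zero)  = sym -0#≈0#
  ⟦-⟧ (+ suc n) = refl
  ⟦-⟧ -[1+ n ]  = sym (-‿involutive _)

  ⟦+⟧ : ∀ i j → ⟦ i ℤ.+ j ⟧ ≈ ⟦ i ⟧ + ⟦ j ⟧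
  ⟦+⟧ (+ m)    (+ n)    = ×-homo-+ 1# m n
  ⟦+⟧ (+ m)    -[1+ n ] = ⟦⊖⟧ m (suc n)
  ⟦+⟧ -[1+ m ] (+ n)    = trans (⟦⊖⟧ n (suc m)) (+-comm _ _)
  ⟦+⟧ -[1+ m ] -[1+ n ] = begin
    - (suc (suc (m ℕ.+ n)) × 1#)       ≡⟨ ≡.cong (λ k → - (suc k × 1#)) (ℕP.+-suc m n) ⟨
    - ((suc m ℕ.+ suc n) × 1#)         ≈⟨ -‿cong (×-homo-+ 1# (suc m) (suc n)) ⟩
    - (suc m × 1# + suc n × 1#)        ≈⟨ -‿+-comm _ _ ⟨
    - (suc m × 1#) + - (suc n × 1#)    ∎

  ⟦+*⟧ : ∀ m j → ⟦ + m ℤ.* j ⟧ ≈ m × 1# * ⟦ j ⟧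
  ⟦+*⟧ zero    j = sym (zeroˡ _)
  ⟦+*⟧ (suc m) j = begin
    ⟦ + suc m ℤ.* j ⟧                 ≡⟨ ≡.cong ⟦_⟧ (ℤP.suc-* (+ m) j) ⟩
    ⟦ j ℤ.+ + m ℤ.* j ⟧               ≈⟨ trans (⟦+⟧ j _) (+-congˡ (⟦+*⟧ m j)) ⟩
    ⟦ j ⟧ + m × 1# * ⟦ j ⟧            ≈⟨ +-congʳ (*-identityˡ _) ⟨
    1# * ⟦ j ⟧ + m × 1# * ⟦ j ⟧       ≈⟨ distribʳ _ _ _ ⟨
    (1# + m × 1#) * ⟦ j ⟧             ≈⟨ *-congʳ (1+× m 1#) ⟨
    suc m × 1# * ⟦ j ⟧                ∎

  ⟦*⟧ : ∀ i j → ⟦ i ℤ.* j ⟧ ≈ ⟦ i ⟧ * ⟦ j ⟧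
  ⟦*⟧ (+ m)    j = ⟦+*⟧ m j
  ⟦*⟧ -[1+ m ] j = begin
    ⟦ -[1+ m ] ℤ.* j ⟧                ≡⟨ ≡.cong ⟦_⟧ (ℤP.neg-distribˡ-* (+ suc m) j) ⟨
    ⟦ ℤ.- (+ suc m ℤ.* j) ⟧           ≈⟨ ⟦-⟧ (+ suc m ℤ.* j) ⟩
    - ⟦ + suc m ℤ.* j ⟧               ≈⟨ -‿cong (⟦+*⟧ (suc m) j) ⟩
    - (suc m × 1# * ⟦ j ⟧)            ≈⟨ -‿distribˡ-* _ _ ⟩
    - (suc m × 1#) * ⟦ j ⟧            ∎

  ⟦⟧-morphism : Ring.rawRing ℤP.+-*-ring -Raw-AlmostCommutative⟶ fromCommutativeRing commutativeRing
  ⟦⟧-morphism = record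
    { ⟦_⟧ = ⟦_⟧ ; +-homo = ⟦+⟧ ; *-homo = ⟦*⟧ ; -‿homo = ⟦-⟧ ; 0-homo = refl ; 1-homo = refl }

  equal-coefficients? : ∀ i j → Maybe (⟦ i ⟧ ≈ ⟦ j ⟧)
  equal-coefficients? i j with i ℤP.≟ j
  ... | yes ≡.refl = just refl
  ... | no _       = nothing

  open import Algebra.Solver.Ring (Ring.rawRing ℤP.+-*-ring) (fromCommutativeRing commutativeRing)
    ⟦⟧-morphism equal-coefficients? public
    using (solve; _:=_; _:+_; _:*_; :-_; _:-_; con)

module FieldLemmas {c ℓ : Level} (F : Field c ℓ) where
  open Field F
  open IntegerCoefficients F
  open SetoidReasoning setoid

  ι-+ : ∀ m n → ι (m ℕ.+ n) ≈ ι m + ι n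
  ι-+ zero    n = sym (+-identityˡ _)
  ι-+ (suc m) n = trans (+-congˡ (ι-+ m n)) (sym (+-assoc _ _ _))

  ι-* : ∀ m n → ι (m ℕ.* n) ≈ ι m * ι n
  ι-* zero    n = sym (zeroˡ _)
  ι-* (suc m) n = begin
    ι (n ℕ.+ m ℕ.* n)     ≈⟨ trans (ι-+ n _) (+-congˡ (ι-* m n)) ⟩
    ι n + ι m * ι n       ≈⟨ solve 2 (λ x y → x :+ y :* x := (con (+ 1) :+ y) :* x) refl (ι n) (ι m) ⟩
    (1# + ι m) * ι n      ∎

  ^-+ : ∀ x m n → x ^ (m ℕ.+ n) ≈ x ^ m * x ^ n
  ^-+ x zero    n = sym (*-identityˡ _)
  ^-+ x (suc m) n = trans (*-congˡ (^-+ x m n)) (sym (*-assoc _ _ _))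

  sumTo-cong-< : ∀ n {f g} → (∀ k → k ℕ.< n → f k ≈ g k) → sumTo n f ≈ sumTo n g
  sumTo-cong-< zero    f≈g = refl
  sumTo-cong-< (suc n) f≈g =
    +-cong (sumTo-cong-< n (λ k k<n → f≈g k (ℕP.m<n⇒m<1+n k<n))) (f≈g n (ℕP.n<1+n n))

  sumTo-cong : ∀ n {f g} → (∀ k → f k ≈ g k) → sumTo n f ≈ sumTo n g
  sumTo-cong n f≈g = sumTo-cong-< n (λ k _ → f≈g k)

  sumTo-distrib-+ : ∀ n f g → sumTo n (λ k → f k + g k) ≈ sumTo n f + sumTo n g
  sumTo-distrib-+ zero    f g = sym (+-identityˡ _)
  sumTo-distrib-+ (suc n) f g = trans (+-congʳ (sumTo-distrib-+ n f g))
    (solve 4 (λ a b x y → (a :+ b) :+ (x :+ y) := (a :+ x) :+ (b :+ y)) refl _ _ _ _)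

  *-distribˡ-sumTo : ∀ n x f → x * sumTo n f ≈ sumTo n (λ k → x * f k)
  *-distribˡ-sumTo zero    x f = zeroʳ _
  *-distribˡ-sumTo (suc n) x f = trans (distribˡ _ _ _) (+-congʳ (*-distribˡ-sumTo n x f))

  sumTo-sucˡ : ∀ n f → sumTo (suc n) f ≈ f 0 + sumTo n (λ k → f (suc k))
  sumTo-sucˡ zero    f = trans (+-identityˡ _) (sym (+-identityʳ _))
  sumTo-sucˡ (suc n) f = trans (+-congʳ (sumTo-sucˡ n f)) (+-assoc _ _ _)

  sumTo-+ : ∀ m n f → sumTo (m ℕ.+ n) f ≈ sumTo m f + sumTo n (λ k → f (m ℕ.+ k))
  sumTo-+ m zero    f = begin
    sumTo (m ℕ.+ 0) f  ≡⟨ ≡.cong (λ k → sumTo k f) (ℕP.+-identityʳ m) ⟩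
    sumTo m f          ≈⟨ +-identityʳ _ ⟨
    sumTo m f + 0#     ∎
  sumTo-+ m (suc n) f = begin
    sumTo (m ℕ.+ suc n) f
      ≡⟨ ≡.cong (λ k → sumTo k f) (ℕP.+-suc m n) ⟩
    sumTo (m ℕ.+ n) f + f (m ℕ.+ n)
      ≈⟨ +-congʳ (sumTo-+ m n f) ⟩
    (sumTo m f + sumTo n (λ k → f (m ℕ.+ k))) + f (m ℕ.+ n)
      ≈⟨ +-assoc _ _ _ ⟩
    sumTo m f + sumTo (suc n) (λ k → f (m ℕ.+ k))
      ∎

  sumTo-* : ∀ m n f → sumTo (m ℕ.* n) f ≈ sumTo m (λ j → sumTo n (λ k → f (j ℕ.* n ℕ.+ k)))
  sumTo-* zero    n f = refl
  sumTo-* (suc m) n f = begin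
    sumTo (n ℕ.+ m ℕ.* n) f
      ≡⟨ ≡.cong (λ k → sumTo k f) (ℕP.+-comm n _) ⟩
    sumTo (m ℕ.* n ℕ.+ n) f
      ≈⟨ sumTo-+ (m ℕ.* n) n f ⟩
    sumTo (m ℕ.* n) f + sumTo n (λ k → f (m ℕ.* n ℕ.+ k))
      ≈⟨ +-congʳ (sumTo-* m n f) ⟩
    sumTo (suc m) (λ j → sumTo n (λ k → f (j ℕ.* n ℕ.+ k)))
      ∎

  alternating-telescope : ∀ (f : ℕ → Carrier) n →
    sumTo n (λ k → (- 1#) ^ k * (f (suc k) + f k)) ≈ f 0 - (- 1#) ^ n * f n
  alternating-telescope f zero    = solve 1 (λ a → con (+ 0) := a :- con (+ 1) :* a) refl (f 0)
  alternating-telescope f (suc n) = trans (+-congʳ (alternating-telescope f n))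
    (solve 4 (λ a s b c → (a :- s :* b) :+ s :* (c :+ b) := a :- ((:- con (+ 1)) :* s) :* c) refl
      (f 0) ((- 1#) ^ n) (f n) (f (suc n)))

-- Sequences a stand for exponential generating functions Σ aₙ tⁿ/n!; ∂ is
-- d/dt, and scale w is the substitution t ↦ w t.
module ExponentialSeries {c ℓ : Level} (F : Field c ℓ) where
  open Field F
  open IntegerCoefficients F
  open FieldLemmas F
  open SetoidReasoning setoid

  Seq : Set c
  Seq = ℕ → Carrier

  infix 4 _≋_
  _≋_ : Seq → Seq → Set ℓ
  a ≋ b = ∀ n → a n ≈ b n

  ≋-setoid : Setoid c ℓ
  ≋-setoid = record
    { Carrier       = Seq
    ; _≈_           = _≋_
    ; isEquivalence = record
      { refl  = λ n → refl
      ; sym   = λ a≋b n → sym (a≋b n)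
      ; trans = λ a≋b b≋c n → trans (a≋b n) (b≋c n)
      }
    }

  δ : Seq
  δ zero    = 1#
  δ (suc n) = 0#

  ∂ : Seq → Seq
  ∂ a n = a (suc n)

  infixl 6 _⊕_
  _⊕_ : Seq → Seq → Seq
  (a ⊕ b) n = a n + b n

  infixr 8 _·_
  _·_ : Carrier → Seq → Seq
  (x · a) n = x * a n

  ∑ : ℕ → (ℕ → Seq) → Seq
  ∑ m G n = sumTo m (λ k → G k n)

  scale : Carrier → Seq → Seq
  scale w a n = w ^ n * a n

  -- The product of exponential generating functions, via ∂(a b) = ∂a b + a ∂b.
  infixl 7 _⋆_
  _⋆_ : Seq → Seq → Seq
  (a ⋆ b) zero    = a 0 * b 0
  (a ⋆ b) (suc n) = (∂ a ⋆ b) n + (a ⋆ ∂ b) n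

  ·-cong : ∀ x {a b} → a ≋ b → x · a ≋ x · b
  ·-cong x a≋b n = *-congˡ (a≋b n)

  ∑-cong : ∀ m {G H : ℕ → Seq} → (∀ k → G k ≋ H k) → ∑ m G ≋ ∑ m H
  ∑-cong m G≋H n = sumTo-cong m (λ k → G≋H k n)

  *-· : ∀ x y a → (x * y) · a ≋ x · y · a
  *-· x y a n = *-assoc x y (a n)

  ·-∑ : ∀ x m G → x · ∑ m G ≋ ∑ m (λ k → x · G k)
  ·-∑ x m G n = *-distribˡ-sumTo m x _

  ∑-* : ∀ m k G → ∑ (m ℕ.* k) G ≋ ∑ m (λ i → ∑ k (λ j → G (i ℕ.* k ℕ.+ j)))
  ∑-* m k G n = sumTo-* m k _

  ⋆-cong : ∀ {a a′ b b′} → a ≋ a′ → b ≋ b′ → a ⋆ b ≋ a′ ⋆ b′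
  ⋆-cong a≋a′ b≋b′ zero    = *-cong (a≋a′ 0) (b≋b′ 0)
  ⋆-cong a≋a′ b≋b′ (suc n) =
    +-cong (⋆-cong (λ m → a≋a′ (suc m)) b≋b′ n) (⋆-cong a≋a′ (λ m → b≋b′ (suc m)) n)

  ⋆-comm : ∀ a b → a ⋆ b ≋ b ⋆ a
  ⋆-comm a b zero    = *-comm _ _
  ⋆-comm a b (suc n) = trans (+-cong (⋆-comm (∂ a) b n) (⋆-comm a (∂ b) n)) (+-comm _ _)

  ⋆-distribʳ-⊕ : ∀ a b c → (a ⊕ b) ⋆ c ≋ a ⋆ c ⊕ b ⋆ c
  ⋆-distribʳ-⊕ a b c zero    = distribʳ _ _ _
  ⋆-distribʳ-⊕ a b c (suc n) =
    trans (+-cong (⋆-distribʳ-⊕ (∂ a) (∂ b) c n) (⋆-distribʳ-⊕ a b (∂ c) n))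
    (solve 4 (λ a b x y → (a :+ b) :+ (x :+ y) := (a :+ x) :+ (b :+ y)) refl _ _ _ _)

  ⋆-distribˡ-⊕ : ∀ a b c → a ⋆ (b ⊕ c) ≋ a ⋆ b ⊕ a ⋆ c
  ⋆-distribˡ-⊕ a b c n = trans (⋆-comm a _ n)
    (trans (⋆-distribʳ-⊕ b c a n) (+-cong (⋆-comm b a n) (⋆-comm c a n)))

  ·-⋆ : ∀ x a b → (x · a) ⋆ b ≋ x · (a ⋆ b)
  ·-⋆ x a b zero    = *-assoc _ _ _
  ·-⋆ x a b (suc n) = trans (+-cong (·-⋆ x (∂ a) b n) (·-⋆ x a (∂ b) n)) (sym (distribˡ _ _ _))

  ⋆-· : ∀ x a b → a ⋆ (x · b) ≋ x · (a ⋆ b)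
  ⋆-· x a b n = trans (⋆-comm a _ n) (trans (·-⋆ x b a n) (*-congˡ (⋆-comm b a n)))

  ⋆-zeroˡ : ∀ b → (λ _ → 0#) ⋆ b ≋ (λ _ → 0#)
  ⋆-zeroˡ b zero    = zeroˡ _
  ⋆-zeroˡ b (suc n) = trans (+-cong (⋆-zeroˡ b n) (⋆-zeroˡ (∂ b) n)) (+-identityʳ _)

  ⋆-identityˡ : ∀ b → δ ⋆ b ≋ b
  ⋆-identityˡ b zero    = *-identityˡ _
  ⋆-identityˡ b (suc n) = trans (+-cong (⋆-zeroˡ b n) (⋆-identityˡ (∂ b) n)) (+-identityˡ _)

  ⋆-identityʳ : ∀ a → a ⋆ δ ≋ a
  ⋆-identityʳ a n = trans (⋆-comm a δ n) (⋆-identityˡ a n)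

  ⋆-assoc : ∀ a b c → (a ⋆ b) ⋆ c ≋ a ⋆ (b ⋆ c)
  ⋆-assoc a b c zero    = *-assoc _ _ _
  ⋆-assoc a b c (suc n) = begin
    (∂ (a ⋆ b) ⋆ c) n + (a ⋆ b ⋆ ∂ c) n
      ≈⟨ +-congʳ (⋆-distribʳ-⊕ (∂ a ⋆ b) (a ⋆ ∂ b) c n) ⟩
    ((∂ a ⋆ b) ⋆ c) n + ((a ⋆ ∂ b) ⋆ c) n + (a ⋆ b ⋆ ∂ c) n
      ≈⟨ +-cong (+-cong (⋆-assoc (∂ a) b c n) (⋆-assoc a (∂ b) c n)) (⋆-assoc a b (∂ c) n) ⟩
    (∂ a ⋆ (b ⋆ c)) n + (a ⋆ (∂ b ⋆ c)) n + (a ⋆ (b ⋆ ∂ c)) n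
      ≈⟨ +-assoc _ _ _ ⟩
    (∂ a ⋆ (b ⋆ c)) n + ((a ⋆ (∂ b ⋆ c)) n + (a ⋆ (b ⋆ ∂ c)) n)
      ≈⟨ +-congˡ (⋆-distribˡ-⊕ a (∂ b ⋆ c) (b ⋆ ∂ c) n) ⟨
    (∂ a ⋆ (b ⋆ c)) n + (a ⋆ ∂ (b ⋆ c)) n
      ∎

  ⋆-commutativeMonoid : CommutativeMonoid c ℓ
  ⋆-commutativeMonoid = record
    { Carrier = Seq ; _≈_ = _≋_ ; _∙_ = _⋆_ ; ε = δ
    ; isCommutativeMonoid = record
      { isMonoid = record
        { isSemigroup = record
          { isMagma = record { isEquivalence = Setoid.isEquivalence ≋-setoid ; ∙-cong = ⋆-cong }
          ; assoc   = ⋆-assoc }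
        ; identity = ⋆-identityˡ , ⋆-identityʳ }
      ; comm = ⋆-comm }
    }

  ∑-⋆ : ∀ m G b → ∑ m G ⋆ b ≋ ∑ m (λ k → G k ⋆ b)
  ∑-⋆ zero    G b = ⋆-zeroˡ b
  ∑-⋆ (suc m) G b n = trans (⋆-distribʳ-⊕ (∑ m G) (G m) b n) (+-congʳ (∑-⋆ m G b n))

  ⋆-∑ : ∀ m a G → a ⋆ ∑ m G ≋ ∑ m (λ k → a ⋆ G k)
  ⋆-∑ m a G n = trans (⋆-comm a _ n) (trans (∑-⋆ m G a n) (sumTo-cong m (λ k → ⋆-comm (G k) a n)))

  scale-cong : ∀ w {a b} → a ≋ b → scale w a ≋ scale w b
  scale-cong w a≋b n = *-congˡ (a≋b n)

  scale-· : ∀ w x a → scale w (x · a) ≋ x · scale w a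
  scale-· w x a n = solve 3 (λ p x a → p :* (x :* a) := x :* (p :* a)) refl (w ^ n) x (a n)

  scale-∑ : ∀ w m G → scale w (∑ m G) ≋ ∑ m (λ k → scale w (G k))
  scale-∑ w m G n = *-distribˡ-sumTo m (w ^ n) _

  scale-⋆ : ∀ w a b → scale w (a ⋆ b) ≋ scale w a ⋆ scale w b
  scale-⋆ w a b zero    =
    solve 2 (λ a b → con (+ 1) :* (a :* b) := (con (+ 1) :* a) :* (con (+ 1) :* b)) refl (a 0) (b 0)
  scale-⋆ w a b (suc n) = begin
    (w * w ^ n) * ((∂ a ⋆ b) n + (a ⋆ ∂ b) n)
      ≈⟨ solve 4 (λ w p x y → (w :* p) :* (x :+ y) := w :* (p :* x) :+ w :* (p :* y)) refl w (w ^ n) _ _ ⟩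
    w * scale w (∂ a ⋆ b) n + w * scale w (a ⋆ ∂ b) n
      ≈⟨ +-cong (*-congˡ (scale-⋆ w (∂ a) b n)) (*-congˡ (scale-⋆ w a (∂ b) n)) ⟩
    (w · (scale w (∂ a) ⋆ scale w b)) n + (w · (scale w a ⋆ scale w (∂ b))) n
      ≈⟨ +-cong (·-⋆ w _ _ n) (⋆-· w _ _ n) ⟨
    ((w · scale w (∂ a)) ⋆ scale w b) n + (scale w a ⋆ (w · scale w (∂ b))) n
      ≈⟨ +-cong (⋆-cong (λ m → sym (*-assoc _ _ _)) (λ m → refl) n)
                (⋆-cong (λ m → refl) (λ m → sym (*-assoc _ _ _)) n) ⟩
    (∂ (scale w a) ⋆ scale w b) n + (scale w a ⋆ ∂ (scale w b)) n
      ∎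

module Series {c ℓ : Level} (F : CharZeroField c ℓ) where
  open CharZeroField F
  open Ops F
  open IntegerCoefficients field'
  open FieldLemmas field'
  open ExponentialSeries field'
  open SetoidReasoning setoid

  ⊛-suc : ∀ a b n → (a ⊛ b) (suc n) ≈ (∂ a ⊛ b) n + (a ⊛ ∂ b) n
  ⊛-suc a b n = begin
    (a ⊛ b) (suc n)
      ≈⟨ sumTo-sucˡ (suc n) _ ⟩
    x₀ + sumTo (suc n) (λ k → ι (suc n C suc k) * a (suc k) * b (n ℕ.∸ k))
      ≈⟨ +-congˡ (trans (sumTo-cong (suc n) pascal) (sumTo-distrib-+ (suc n) _ _)) ⟩
    x₀ + (S₁ + (S₂′ + ι (n C suc n) * a (suc n) * b (n ℕ.∸ n)))
      ≈⟨ +-congˡ (+-congˡ (+-cong (sumTo-cong-< n shift) top)) ⟩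
    x₀ + (S₁ + (S₂ + 0#))
      ≈⟨ solve 3 (λ x y z → x :+ (y :+ (z :+ con (+ 0))) := y :+ (x :+ z)) refl x₀ S₁ S₂ ⟩
    S₁ + (x₀ + S₂)
      ≈⟨ +-congˡ (sumTo-sucˡ n _) ⟨
    (∂ a ⊛ b) n + (a ⊛ ∂ b) n
      ∎
    where
    x₀ = ι (suc n C 0) * a 0 * b (suc n)
    S₁ = sumTo (suc n) (λ k → ι (n C k) * a (suc k) * b (n ℕ.∸ k))
    S₂′ = sumTo n (λ k → ι (n C suc k) * a (suc k) * b (n ℕ.∸ k))
    S₂ = sumTo n (λ k → ι (n C suc k) * a (suc k) * b (suc (n ℕ.∸ suc k)))

    pascal : ∀ k → ι (suc n C suc k) * a (suc k) * b (n ℕ.∸ k)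
                   ≈ ι (n C k) * a (suc k) * b (n ℕ.∸ k) + ι (n C suc k) * a (suc k) * b (n ℕ.∸ k)
    pascal k = begin
      ι (suc n C suc k) * a (suc k) * b (n ℕ.∸ k)
        ≡⟨ ≡.cong (λ m → ι m * a (suc k) * b (n ℕ.∸ k)) (nCk+nC[k+1]≡[n+1]C[k+1] n k) ⟨
      ι (n C k ℕ.+ n C suc k) * a (suc k) * b (n ℕ.∸ k)
        ≈⟨ *-congʳ (*-congʳ (ι-+ (n C k) _)) ⟩
      (ι (n C k) + ι (n C suc k)) * a (suc k) * b (n ℕ.∸ k)
        ≈⟨ solve 4 (λ x y z w → (x :+ y) :* z :* w := x :* z :* w :+ y :* z :* w) refl _ _ _ _ ⟩
      ι (n C k) * a (suc k) * b (n ℕ.∸ k) + ι (n C suc k) * a (suc k) * b (n ℕ.∸ k)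
        ∎

    shift : ∀ k → k ℕ.< n → ι (n C suc k) * a (suc k) * b (n ℕ.∸ k)
                            ≈ ι (n C suc k) * a (suc k) * b (suc (n ℕ.∸ suc k))
    shift k k<n = reflexive (≡.cong (λ m → ι (n C suc k) * a (suc k) * b m) (ℕP.+-∸-assoc 1 k<n))

    top : ι (n C suc n) * a (suc n) * b (n ℕ.∸ n) ≈ 0#
    top = begin
      ι (n C suc n) * a (suc n) * b (n ℕ.∸ n)
        ≡⟨ ≡.cong (λ m → ι m * a (suc n) * b (n ℕ.∸ n)) (k>n⇒nCk≡0 (ℕP.n<1+n n)) ⟩
      0# * a (suc n) * b (n ℕ.∸ n)
        ≈⟨ trans (*-congʳ (zeroˡ _)) (zeroˡ _) ⟩
      0#
        ∎

  ⊛≋⋆ : ∀ a b → a ⊛ b ≋ a ⋆ b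
  ⊛≋⋆ a b zero    =
    solve 2 (λ x y → con (+ 0) :+ (con (+ 1) :+ con (+ 0)) :* x :* y := x :* y) refl (a 0) (b 0)
  ⊛≋⋆ a b (suc n) = trans (⊛-suc a b n) (+-cong (⊛≋⋆ (∂ a) b n) (⊛≋⋆ a (∂ b) n))

  final-term : ∀ (a b : Seq) n → ι (n C n) * a n * b (n ℕ.∸ n) ≈ a n * b 0
  final-term a b n = begin
    ι (n C n) * a n * b (n ℕ.∸ n)
      ≡⟨ ≡.cong₂ (λ i j → ι i * a n * b j) (nCn≡1 n) (ℕP.n∸n≡0 n) ⟩
    (1# + 0#) * a n * b 0
      ≈⟨ solve 2 (λ x y → (con (+ 1) :+ con (+ 0)) :* x :* y := x :* y) refl (a n) (b 0) ⟩
    a n * b 0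
      ∎

  -- egfDiv N D n is the diagonal entry of a table that Ops keeps private.
  -- Unfolding egfDiv N D (suc n) exposes row n of that table, which
  -- unification then lets us name.
  next : (N D : Seq) → ℕ → Seq → Carrier
  next N D n q = (N (suc n) - sumTo (suc n) (λ j → ι (suc n C j) * q j * D (suc n ℕ.∸ j))) * D 0 ⁻¹

  row : (N D : Seq) → ℕ → Seq
  row N D n = recover ≡.refl
    where
    recover : ∀ {q} → egfDiv N D (suc n) ≡ (if n ℕ.<ᵇ n then q (suc n) else next N D n q) → Seq
    recover {q} _ = q

  row-stable : ∀ N D n k → k ℕ.≤ n → row N D n k ≡ egfDiv N D k
  row-stable N D zero    .zero ℕ.z≤n = ≡.refl
  row-stable N D (suc n) k     k≤1+n with ℕP.m≤n⇒m<n∨m≡n k≤1+n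
  ... | inj₂ ≡.refl      = ≡.refl
  ... | inj₁ (ℕ.s≤s k≤n) = ≡.trans
    (≡.cong (λ b → if b then row N D n k else next N D n (row N D n)) (dec-true (k ℕ.≤? n) k≤n))
    (row-stable N D n k k≤n)

  egfDiv-suc : ∀ N D n → egfDiv N D (suc n) ≡ next N D n (row N D n)
  egfDiv-suc N D n =
    ≡.cong (λ b → if b then row N D n (suc n) else next N D n (row N D n))
      (dec-false (suc n ℕ.≤? n) (ℕP.<-irrefl ≡.refl))

  egfDiv-⊛ : ∀ N D → ¬ (D 0 ≈ 0#) → egfDiv N D ⊛ D ≋ N
  egfDiv-⊛ N D D₀≉0 zero = begin
    0# + (1# + 0#) * (N 0 * D 0 ⁻¹) * D 0
      ≈⟨ solve 3 (λ n d e → con (+ 0) :+ (con (+ 1) :+ con (+ 0)) :* (n :* e) :* d := n :* (d :* e))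
           refl (N 0) (D 0) (D 0 ⁻¹) ⟩
    N 0 * (D 0 * D 0 ⁻¹)   ≈⟨ *-congˡ (⁻¹-inverse _ D₀≉0) ⟩
    N 0 * 1#               ≈⟨ *-identityʳ _ ⟩
    N 0                    ∎
  egfDiv-⊛ N D D₀≉0 (suc m) = begin
    sumTo (suc m) (λ j → ι (suc m C j) * egfDiv N D j * D (suc m ℕ.∸ j))
      + ι (suc m C suc m) * egfDiv N D (suc m) * D (suc m ℕ.∸ suc m)
      ≈⟨ +-cong (sumTo-cong-< (suc m) earlier) (final-term (egfDiv N D) D (suc m)) ⟩
    X + egfDiv N D (suc m) * D 0
      ≡⟨ ≡.cong (λ y → X + y * D 0) (egfDiv-suc N D m) ⟩
    X + (N (suc m) - X) * D 0 ⁻¹ * D 0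
      ≈⟨ solve 4 (λ x n e d → x :+ (n :- x) :* e :* d := n :+ (n :- x) :* (d :* e :- con (+ 1)))
           refl X (N (suc m)) (D 0 ⁻¹) (D 0) ⟩
    N (suc m) + (N (suc m) - X) * (D 0 * D 0 ⁻¹ - 1#)
      ≈⟨ +-congˡ (trans (*-congˡ (trans (+-congʳ (⁻¹-inverse _ D₀≉0)) (-‿inverseʳ 1#))) (zeroʳ _)) ⟩
    N (suc m) + 0#
      ≈⟨ +-identityʳ _ ⟩
    N (suc m)
      ∎
    where
    X = sumTo (suc m) (λ j → ι (suc m C j) * row N D m j * D (suc m ℕ.∸ j))
    earlier : ∀ j → j ℕ.< suc m → ι (suc m C j) * egfDiv N D j * D (suc m ℕ.∸ j)
                                   ≈ ι (suc m C j) * row N D m j * D (suc m ℕ.∸ j)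
    earlier j j<1+m = reflexive (≡.cong (λ y → ι (suc m C j) * y * D (suc m ℕ.∸ j))
      (≡.sym (row-stable N D m j (ℕP.≤-pred j<1+m))))

  egfDiv-⋆ : ∀ N D → ¬ (D 0 ≈ 0#) → egfDiv N D ⋆ D ≋ N
  egfDiv-⋆ N D D₀≉0 n = trans (sym (⊛≋⋆ (egfDiv N D) D n)) (egfDiv-⊛ N D D₀≉0 n)

  ⋆-cancelʳ : ∀ {a b} c → ¬ (c 0 ≈ 0#) → a ⋆ c ≋ b ⋆ c → a ≋ b
  ⋆-cancelʳ {a} {b} c c₀≉0 ac≋bc n =
    trans (sym (undo a n)) (trans (⋆-cong ac≋bc (λ _ → refl) n) (undo b n))
    where
    c⋆c⁻¹ : c ⋆ egfDiv δ c ≋ δ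
    c⋆c⁻¹ k = trans (⋆-comm c _ k) (egfDiv-⋆ δ c c₀≉0 k)
    undo : ∀ x → (x ⋆ c) ⋆ egfDiv δ c ≋ x
    undo x k = trans (⋆-assoc x c _ k) (trans (⋆-cong (λ _ → refl) c⋆c⁻¹ k) (⋆-identityʳ x k))

  dff-cong : ∀ {x y μ ν} → x ≈ y → μ ≈ ν → dff x μ ≋ dff y ν
  dff-cong x≈y μ≈ν zero    = refl
  dff-cong x≈y μ≈ν (suc n) = *-cong (dff-cong x≈y μ≈ν n) (+-cong x≈y (-‿cong (*-congˡ μ≈ν)))

  ∂-dff : ∀ x μ → ∂ (dff x μ) ≋ x · dff (x - μ) μ
  ∂-dff x μ zero    = solve 2 (λ x μ → con (+ 1) :* (x :- con (+ 0) :* μ) := x :* con (+ 1)) refl x μ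
  ∂-dff x μ (suc n) = begin
    dff x μ (suc n) * (x - (1# + ι n) * μ)        ≈⟨ *-congʳ (∂-dff x μ n) ⟩
    (x * dff (x - μ) μ n) * (x - (1# + ι n) * μ)
      ≈⟨ solve 4 (λ x p i μ → (x :* p) :* (x :- (con (+ 1) :+ i) :* μ) := x :* (p :* ((x :- μ) :- i :* μ)))
           refl x (dff (x - μ) μ n) (ι n) μ ⟩
    x * (dff (x - μ) μ n * ((x - μ) - ι n * μ))   ∎

  dff-0 : ∀ μ → dff 0# μ ≋ δ
  dff-0 μ zero    = refl
  dff-0 μ (suc n) = trans (∂-dff 0# μ n) (zeroˡ _)

  dff-+ : ∀ x y μ → dff (x + y) μ ≋ dff x μ ⋆ dff y μ
  dff-+ x y μ zero    = sym (*-identityˡ _)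
  dff-+ x y μ (suc n) = begin
    dff (x + y) μ (suc n)
      ≈⟨ trans (∂-dff (x + y) μ n) (distribʳ _ _ _) ⟩
    x * dff ((x + y) - μ) μ n + y * dff ((x + y) - μ) μ n
      ≈⟨ +-cong (*-congˡ (dff-cong (solve 3 (λ x y μ → (x :+ y) :- μ := (x :- μ) :+ y) refl x y μ) refl n))
                (*-congˡ (dff-cong (solve 3 (λ x y μ → (x :+ y) :- μ := x :+ (y :- μ)) refl x y μ) refl n)) ⟩
    x * dff ((x - μ) + y) μ n + y * dff (x + (y - μ)) μ n
      ≈⟨ +-cong (*-congˡ (dff-+ (x - μ) y μ n)) (*-congˡ (dff-+ x (y - μ) μ n)) ⟩
    (x · (dff (x - μ) μ ⋆ dff y μ)) n + (y · (dff x μ ⋆ dff (y - μ) μ)) n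
      ≈⟨ +-cong (·-⋆ x _ _ n) (⋆-· y _ _ n) ⟨
    ((x · dff (x - μ) μ) ⋆ dff y μ) n + (dff x μ ⋆ (y · dff (y - μ) μ)) n
      ≈⟨ +-cong (⋆-cong (λ m → sym (∂-dff x μ m)) (λ _ → refl) n)
                (⋆-cong (λ _ → refl) (λ m → sym (∂-dff y μ m)) n) ⟩
    (∂ (dff x μ) ⋆ dff y μ) n + (dff x μ ⋆ ∂ (dff y μ)) n
      ∎

  scale-dff : ∀ w x μ → scale w (dff x μ) ≋ dff (w * x) (w * μ)
  scale-dff w x μ zero    = *-identityˡ _
  scale-dff w x μ (suc n) = begin
    (w * w ^ n) * (dff x μ n * (x - ι n * μ))
      ≈⟨ solve 6 (λ w p f x i μ → (w :* p) :* (f :* (x :- i :* μ)) := (p :* f) :* (w :* x :- i :* (w :* μ)))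
           refl w (w ^ n) (dff x μ n) x (ι n) μ ⟩
    scale w (dff x μ) n * (w * x - ι n * (w * μ))
      ≈⟨ *-congʳ (scale-dff w x μ n) ⟩
    dff (w * x) (w * μ) n * (w * x - ι n * (w * μ))
      ∎

  sgn-+ : ∀ m n → sgn (m ℕ.+ n) ≈ sgn m * sgn n
  sgn-+ = ^-+ (- 1#)

  sgn-even : ∀ q → sgn (q ℕ.* 2) ≈ 1#
  sgn-even zero    = refl
  sgn-even (suc q) =
    trans (solve 1 (λ s → (:- con (+ 1)) :* ((:- con (+ 1)) :* s) := s) refl (sgn (q ℕ.* 2))) (sgn-even q)

  sgn-odd : ∀ k → Odd k → sgn k ≈ - 1#
  sgn-odd k k-odd = begin
    sgn k
      ≡⟨ ≡.cong sgn (≡.trans (m≡m%n+[m/n]*n k 2) (≡.cong (ℕ._+ (k / 2) ℕ.* 2) k-odd)) ⟩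
    - 1# * sgn ((k / 2) ℕ.* 2)  ≈⟨ *-congˡ (sgn-even (k / 2)) ⟩
    - 1# * 1#                   ≈⟨ *-identityʳ _ ⟩
    - 1#                        ∎

  sgn-*-odd : ∀ d → Odd d → ∀ j → sgn (j ℕ.* d) ≈ sgn j
  sgn-*-odd d d-odd zero    = refl
  sgn-*-odd d d-odd (suc j) = trans (sgn-+ d (j ℕ.* d)) (*-cong (sgn-odd d d-odd) (sgn-*-odd d d-odd j))

  alternating-geometric : ∀ w L μ → Odd w →
    ∑ w (λ j → sgn j · dff (ι j * L) μ) ⋆ (dff L μ ⊕ δ) ≋ dff (ι w * L) μ ⊕ δ
  alternating-geometric w L μ w-odd m = begin
    (V ⋆ (dff L μ ⊕ δ)) m
      ≈⟨ trans (⋆-distribˡ-⊕ V _ δ m) (+-cong (∑-⋆ w _ _ m) (⋆-identityʳ V m)) ⟩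
    sumTo w (λ j → ((sgn j · v j) ⋆ dff L μ) m) + V m
      ≈⟨ +-congʳ (sumTo-cong w (λ j → trans (·-⋆ (sgn j) _ _ m) (*-congˡ (v-suc j m)))) ⟩
    sumTo w (λ j → sgn j * v (suc j) m) + V m
      ≈⟨ trans (sumTo-cong w (λ j → distribˡ _ _ _)) (sumTo-distrib-+ w _ _) ⟨
    sumTo w (λ j → sgn j * (v (suc j) m + v j m))
      ≈⟨ alternating-telescope (λ j → v j m) w ⟩
    v 0 m - sgn w * v w m
      ≈⟨ +-cong (trans (dff-cong (zeroˡ L) refl m) (dff-0 μ m)) (-‿cong (*-congʳ (sgn-odd w w-odd))) ⟩
    δ m - (- 1#) * v w m
      ≈⟨ solve 2 (λ a b → a :- (:- con (+ 1)) :* b := b :+ a) refl (δ m) (v w m) ⟩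
    v w m + δ m
      ∎
    where
    v : ℕ → Seq
    v j = dff (ι j * L) μ
    V = ∑ w (λ j → sgn j · v j)
    v-suc : ∀ j → v j ⋆ dff L μ ≋ v (suc j)
    v-suc j k = trans (sym (dff-+ (ι j * L) L μ k))
      (dff-cong (solve 2 (λ j L → j :* L :+ L := (con (+ 1) :+ j) :* L) refl (ι j) L) refl k)

module Symmetry {c ℓ : Level} (F : CharZeroField c ℓ) (d : ℕ) (d-odd : Odd d)
  (χ : ℤ → CharZeroField.Carrier F)
  (χ-periodic : ∀ a → CharZeroField._≈_ F (χ (a ℤ.+ + d)) (χ a))
  (λ' x : CharZeroField.Carrier F) where
  open CharZeroField F
  open Ops F
  open IntegerCoefficients field'
  open FieldLemmas field'
  open ExponentialSeries field'
  open Series F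
  open Setoid ≋-setoid using () renaming (refl to ≋-refl; sym to ≋-sym; trans to ≋-trans)
  open import Algebra.Solver.CommutativeMonoid ⋆-commutativeMonoid using (_⊜_)
    renaming (solve to ⋆-solve; _⊕_ to _⊙_)

  u : Carrier → Seq
  u y = dff y λ'

  μ : ℕ → Carrier
  μ w = λ' * ι w ⁻¹

  ε : ℕ → Carrier
  ε l = sgn l * χ (+ l)

  A : ℕ → Seq
  A w = ∑ d (λ a → ε a · u (ι w * ι a))

  B : ℕ → ℕ → Seq
  B w w′ = ∑ (d ℕ.* w) (λ l → ε l · u (ι w′ * ι l))

  D : ℕ → Seq
  D w = u (ι w * ι d) ⊕ δ

  Q : ℕ → Seq
  Q w = egfDiv (numer d χ (μ w)) (denom d (μ w))

  T : ℕ → ℕ → Seq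
  T w w′ = scale (ι w) (Q w) ⋆ (u (ι (w ℕ.* w′) * x) ⋆ B w w′)

  2≉0 : ¬ (1# + 1# ≈ 0#)
  2≉0 2≈0 = char0 1 (trans (+-congˡ (+-identityʳ 1#)) 2≈0)

  ι-odd-invertible : ∀ w → Odd w → ι w * ι w ⁻¹ ≈ 1#
  ι-odd-invertible zero    ()
  ι-odd-invertible (suc w) _ = ⁻¹-inverse (ι (suc w)) (char0 w)

  scale-u : ∀ w → Odd w → ∀ y → scale (ι w) (dff y (μ w)) ≋ u (ι w * y)
  scale-u w w-odd y = ≋-trans (scale-dff (ι w) y (μ w)) (dff-cong refl w·μ≈λ)
    where
    w·μ≈λ : ι w * μ w ≈ λ'
    w·μ≈λ = trans (solve 3 (λ w l i → w :* (l :* i) := l :* (w :* i)) refl (ι w) λ' (ι w ⁻¹))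
                  (trans (*-congˡ (ι-odd-invertible w w-odd)) (*-identityʳ λ'))

  scale-Q⋆D : ∀ w → Odd w → scale (ι w) (Q w) ⋆ D w ≋ ι 2 · A w
  scale-Q⋆D w w-odd = begin
    scale (ι w) (Q w) ⋆ D w
      ≈⟨ ⋆-cong ≋-refl (≋-sym scale-denom) ⟩
    scale (ι w) (Q w) ⋆ scale (ι w) (denom d (μ w))
      ≈⟨ scale-⋆ (ι w) _ _ ⟨
    scale (ι w) (Q w ⋆ denom d (μ w))
      ≈⟨ scale-cong (ι w) (egfDiv-⋆ _ _ 2≉0) ⟩
    scale (ι w) (ι 2 · ∑ d (λ a → ε a · dff (ι a) (μ w)))
      ≈⟨ ≋-trans (scale-· (ι w) (ι 2) _) (·-cong (ι 2) (scale-∑ (ι w) d _)) ⟩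
    ι 2 · ∑ d (λ a → scale (ι w) (ε a · dff (ι a) (μ w)))
      ≈⟨ ·-cong (ι 2) (∑-cong d (λ a →
           ≋-trans (scale-· (ι w) (ε a) _) (·-cong (ε a) (scale-u w w-odd (ι a))))) ⟩
    ι 2 · A w
      ∎
    where
    open SetoidReasoning ≋-setoid
    scale-denom : scale (ι w) (denom d (μ w)) ≋ D w
    scale-denom zero    = *-identityˡ _
    scale-denom (suc n) = trans (scale-u w w-odd (ι d) (suc n)) (sym (+-identityʳ _))

  χ-periodic-ℕ : ∀ j a → χ (+ (j ℕ.* d ℕ.+ a)) ≈ χ (+ a)
  χ-periodic-ℕ zero    a = refl
  χ-periodic-ℕ (suc j) a = begin
    χ (+ ((d ℕ.+ j ℕ.* d) ℕ.+ a))  ≡⟨ ≡.cong (λ k → χ (+ k)) (≡.trans (ℕP.+-assoc d _ a) (ℕP.+-comm d _)) ⟩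
    χ (+ (j ℕ.* d ℕ.+ a) ℤ.+ + d)   ≈⟨ χ-periodic _ ⟩
    χ (+ (j ℕ.* d ℕ.+ a))           ≈⟨ χ-periodic-ℕ j a ⟩
    χ (+ a)                         ∎
    where open SetoidReasoning setoid

  ε-block : ∀ j a → ε (j ℕ.* d ℕ.+ a) ≈ sgn j * ε a
  ε-block j a = begin
    sgn (j ℕ.* d ℕ.+ a) * χ (+ (j ℕ.* d ℕ.+ a))
      ≈⟨ *-cong (trans (sgn-+ (j ℕ.* d) a) (*-congʳ (sgn-*-odd d d-odd j))) (χ-periodic-ℕ j a) ⟩
    (sgn j * sgn a) * χ (+ a)
      ≈⟨ *-assoc _ _ _ ⟩
    sgn j * ε a
      ∎
    where open SetoidReasoning setoid

  B-factor : ∀ w w′ → B w w′ ≋ ∑ w (λ j → sgn j · u (ι j * (ι w′ * ι d))) ⋆ A w′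
  B-factor w w′ = begin
    ∑ (d ℕ.* w) (λ l → ε l · u (ι w′ * ι l))
      ≡⟨ ≡.cong (λ k → ∑ k (λ l → ε l · u (ι w′ * ι l))) (ℕP.*-comm d w) ⟩
    ∑ (w ℕ.* d) (λ l → ε l · u (ι w′ * ι l))
      ≈⟨ ∑-* w d _ ⟩
    ∑ w (λ j → ∑ d (λ a → ε (j ℕ.* d ℕ.+ a) · u (ι w′ * ι (j ℕ.* d ℕ.+ a))))
      ≈⟨ ∑-cong w (λ j → ∑-cong d (block-term j)) ⟩
    ∑ w (λ j → ∑ d (λ a → sgn j · (v j ⋆ (ε a · u (ι w′ * ι a)))))
      ≈⟨ ∑-cong w (λ j → ≋-trans (≋-sym (·-∑ (sgn j) d _)) (·-cong (sgn j) (≋-sym (⋆-∑ d (v j) _)))) ⟩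
    ∑ w (λ j → sgn j · (v j ⋆ A w′))
      ≈⟨ ≋-trans (∑-cong w (λ j → ≋-sym (·-⋆ (sgn j) (v j) (A w′)))) (≋-sym (∑-⋆ w _ (A w′))) ⟩
    ∑ w (λ j → sgn j · v j) ⋆ A w′
      ∎
    where
    open SetoidReasoning ≋-setoid
    v : ℕ → Seq
    v j = u (ι j * (ι w′ * ι d))
    block-term : ∀ j a → ε (j ℕ.* d ℕ.+ a) · u (ι w′ * ι (j ℕ.* d ℕ.+ a))
                         ≋ sgn j · (v j ⋆ (ε a · u (ι w′ * ι a)))
    block-term j a = begin
      ε (j ℕ.* d ℕ.+ a) · u (ι w′ * ι (j ℕ.* d ℕ.+ a))
        ≈⟨ (λ n → *-cong (ε-block j a) (dff-cong split refl n)) ⟩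
      (sgn j * ε a) · u (ι j * (ι w′ * ι d) + ι w′ * ι a)
        ≈⟨ ·-cong (sgn j * ε a) (dff-+ _ _ λ') ⟩
      (sgn j * ε a) · (v j ⋆ u (ι w′ * ι a))
        ≈⟨ ≋-trans (*-· (sgn j) (ε a) _) (·-cong (sgn j) (≋-sym (⋆-· (ε a) (v j) _))) ⟩
      sgn j · (v j ⋆ (ε a · u (ι w′ * ι a)))
        ∎
      where
      split : ι w′ * ι (j ℕ.* d ℕ.+ a) ≈ ι j * (ι w′ * ι d) + ι w′ * ι a
      split = trans (*-congˡ (trans (ι-+ (j ℕ.* d) a) (+-congʳ (ι-* j d))))
        (solve 4 (λ w j d a → w :* (j :* d :+ a) := j :* (w :* d) :+ w :* a) refl (ι w′) (ι j) (ι d) (ι a))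

  B⋆D : ∀ w w′ → Odd w → B w w′ ⋆ D w′ ≋ A w′ ⋆ D (w ℕ.* w′)
  B⋆D w w′ w-odd = begin
    B w w′ ⋆ D w′
      ≈⟨ ⋆-cong (B-factor w w′) ≋-refl ⟩
    V ⋆ A w′ ⋆ D w′
      ≈⟨ ⋆-solve 3 (λ v a e → (v ⊙ a) ⊙ e ⊜ a ⊙ (v ⊙ e)) ≋-refl V (A w′) (D w′) ⟩
    A w′ ⋆ (V ⋆ D w′)
      ≈⟨ ⋆-cong ≋-refl (alternating-geometric w (ι w′ * ι d) λ' w-odd) ⟩
    A w′ ⋆ (u (ι w * (ι w′ * ι d)) ⊕ δ)
      ≈⟨ ⋆-cong ≋-refl (λ n → +-congʳ (dff-cong ww′d refl n)) ⟩
    A w′ ⋆ D (w ℕ.* w′)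
      ∎
    where
    open SetoidReasoning ≋-setoid
    V = ∑ w (λ j → sgn j · u (ι j * (ι w′ * ι d)))
    ww′d : ι w * (ι w′ * ι d) ≈ ι (w ℕ.* w′) * ι d
    ww′d = trans (sym (*-assoc _ _ _)) (*-congʳ (sym (ι-* w w′)))

  E-sum : ∀ w w′ → Odd w →
    scale (ι w) (λ n → sumTo (d ℕ.* w) (λ l → ε l * E d χ (μ w) n (ι w′ * x + ι w′ * ι w ⁻¹ * ι l)))
      ≋ T w w′
  E-sum w w′ w-odd = begin
    scale (ι w) (∑ (d ℕ.* w) (λ l → ε l · (Q w ⊛ dff (y l) (μ w))))
      ≈⟨ ≋-trans (scale-∑ (ι w) (d ℕ.* w) _) (∑-cong (d ℕ.* w) (λ l → scale-· (ι w) (ε l) _)) ⟩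
    ∑ (d ℕ.* w) (λ l → ε l · scale (ι w) (Q w ⊛ dff (y l) (μ w)))
      ≈⟨ ∑-cong (d ℕ.* w) (λ l → ·-cong (ε l) (term l)) ⟩
    ∑ (d ℕ.* w) (λ l → ε l · (SQ ⋆ (U ⋆ u (ι w′ * ι l))))
      ≈⟨ ∑-cong (d ℕ.* w) (λ l → ≋-trans (⋆-cong ≋-refl (⋆-· (ε l) U _)) (⋆-· (ε l) SQ _)) ⟨
    ∑ (d ℕ.* w) (λ l → SQ ⋆ (U ⋆ (ε l · u (ι w′ * ι l))))
      ≈⟨ ≋-trans (⋆-cong ≋-refl (⋆-∑ (d ℕ.* w) U _)) (⋆-∑ (d ℕ.* w) SQ _) ⟨
    T w w′
      ∎
    where
    open SetoidReasoning ≋-setoid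
    SQ = scale (ι w) (Q w)
    U = u (ι (w ℕ.* w′) * x)
    y : ℕ → Carrier
    y l = ι w′ * x + ι w′ * ι w ⁻¹ * ι l
    split : ∀ l → ι w * y l ≈ ι (w ℕ.* w′) * x + ι w′ * ι l
    split l = trans
      (solve 5 (λ a b x e l → a :* (b :* x :+ b :* e :* l) := (a :* b) :* x :+ b :* l :* (a :* e))
         refl (ι w) (ι w′) x (ι w ⁻¹) (ι l))
      (+-cong (*-congʳ (sym (ι-* w w′))) (trans (*-congˡ (ι-odd-invertible w w-odd)) (*-identityʳ _)))
    term : ∀ l → scale (ι w) (Q w ⊛ dff (y l) (μ w)) ≋ SQ ⋆ (U ⋆ u (ι w′ * ι l))
    term l = begin
      scale (ι w) (Q w ⊛ dff (y l) (μ w))  ≈⟨ scale-cong (ι w) (⊛≋⋆ (Q w) _) ⟩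
      scale (ι w) (Q w ⋆ dff (y l) (μ w))  ≈⟨ scale-⋆ (ι w) (Q w) _ ⟩
      SQ ⋆ scale (ι w) (dff (y l) (μ w))   ≈⟨ ⋆-cong ≋-refl (scale-u w w-odd (y l)) ⟩
      SQ ⋆ u (ι w * y l)                   ≈⟨ ⋆-cong ≋-refl (≋-trans (dff-cong (split l) refl) (dff-+ _ _ λ')) ⟩
      SQ ⋆ (U ⋆ u (ι w′ * ι l))            ∎

  T⋆D⋆D : ∀ w w′ → Odd w →
    T w w′ ⋆ D w ⋆ D w′ ≋ ι 2 · ((A w ⋆ A w′) ⋆ (u (ι (w ℕ.* w′) * x) ⋆ D (w ℕ.* w′)))
  T⋆D⋆D w w′ w-odd = begin
    SQ ⋆ (U ⋆ B w w′) ⋆ D w ⋆ D w′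
      ≈⟨ ⋆-solve 5 (λ s a b e e′ → ((s ⊙ (a ⊙ b)) ⊙ e) ⊙ e′ ⊜ (s ⊙ e) ⊙ (a ⊙ (b ⊙ e′)))
           ≋-refl SQ U (B w w′) (D w) (D w′) ⟩
    (SQ ⋆ D w) ⋆ (U ⋆ (B w w′ ⋆ D w′))
      ≈⟨ ⋆-cong (scale-Q⋆D w w-odd) (⋆-cong ≋-refl (B⋆D w w′ w-odd)) ⟩
    (ι 2 · A w) ⋆ (U ⋆ (A w′ ⋆ D (w ℕ.* w′)))
      ≈⟨ ·-⋆ (ι 2) (A w) _ ⟩
    ι 2 · (A w ⋆ (U ⋆ (A w′ ⋆ D (w ℕ.* w′))))
      ≈⟨ ·-cong (ι 2) (⋆-solve 4 (λ a b e f → a ⊙ (e ⊙ (b ⊙ f)) ⊜ (a ⊙ b) ⊙ (e ⊙ f))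
           ≋-refl (A w) (A w′) U (D (w ℕ.* w′))) ⟩
    ι 2 · ((A w ⋆ A w′) ⋆ (U ⋆ D (w ℕ.* w′)))
      ∎
    where
    open SetoidReasoning ≋-setoid
    SQ = scale (ι w) (Q w)
    U = u (ι (w ℕ.* w′) * x)

  T-symmetric : ∀ w w′ → Odd w → Odd w′ → T w w′ ≋ T w′ w
  T-symmetric w w′ w-odd w′-odd = ⋆-cancelʳ (D w) 2≉0 (⋆-cancelʳ (D w′) 2≉0 (begin
    T w w′ ⋆ D w ⋆ D w′
      ≈⟨ T⋆D⋆D w w′ w-odd ⟩
    ι 2 · ((A w ⋆ A w′) ⋆ (u (ι (w ℕ.* w′) * x) ⋆ D (w ℕ.* w′)))
      ≈⟨ ·-cong (ι 2) (⋆-cong (⋆-comm (A w) (A w′)) ≋-refl) ⟩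
    ι 2 · ((A w′ ⋆ A w) ⋆ (u (ι (w ℕ.* w′) * x) ⋆ D (w ℕ.* w′)))
      ≡⟨ ≡.cong (λ k → ι 2 · ((A w′ ⋆ A w) ⋆ (u (ι k * x) ⋆ D k))) (ℕP.*-comm w w′) ⟩
    ι 2 · ((A w′ ⋆ A w) ⋆ (u (ι (w′ ℕ.* w) * x) ⋆ D (w′ ℕ.* w)))
      ≈⟨ T⋆D⋆D w′ w w′-odd ⟨
    T w′ w ⋆ D w′ ⋆ D w
      ≈⟨ ⋆-solve 3 (λ t a b → (t ⊙ a) ⊙ b ⊜ (t ⊙ b) ⊙ a) ≋-refl (T w′ w) (D w′) (D w) ⟩
    T w′ w ⋆ D w ⋆ D w′
      ∎))
    where open SetoidReasoning ≋-setoid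

theorem2 : ∀ {c ℓ : Level} (F : CharZeroField c ℓ) →
    let open CharZeroField F
        open Ops F
    in (w₁ w₂ d : ℕ) → Odd d → Odd w₁ → Odd w₂ →
       (χ : ℤ → Carrier) → IsDirichletChar F d χ → HasConductor F d χ →
       (λ' : Carrier) → ¬ (λ' ≈ 0#) → (x : Carrier) → (n : ℕ) →
       (ι w₂ ^ n) * sumTo (d ℕ.* w₂) (λ l → sgn l * χ (ℤ.+ l) *
          E d χ (λ' * ι w₂ ⁻¹) n (ι w₁ * x + ι w₁ * ι w₂ ⁻¹ * ι l))
       ≈
       (ι w₁ ^ n) * sumTo (d ℕ.* w₁) (λ l → sgn l * χ (ℤ.+ l) *
          E d χ (λ' * ι w₁ ⁻¹) n (ι w₂ * x + ι w₂ * ι w₁ ⁻¹ * ι l))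
theorem2 F w₁ w₂ d d-odd w₁-odd w₂-odd χ χ-dirichlet _ λ' _ x n =
  trans (E-sum w₂ w₁ w₂-odd n)
        (trans (T-symmetric w₂ w₁ w₂-odd w₁-odd n) (sym (E-sum w₁ w₂ w₁-odd n)))
  where
  open CharZeroField F
  open Symmetry F d d-odd χ (IsDirichletChar.periodic χ-dirichlet) λ' x
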